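{- Let $n,k\ge 2$ be integers and let $K_n^k$ denote the one point union of $k$ copies of the complete graph $K_n$. Then $$hc(K_n^k)=\begin{cases}(n-1)^2, & \text{if } k=2,\\ k(k-2)(n-1)^2+n-1, & \text{if } k\ge 3.\end{cases}$$
   Context: $K_n^k$ is the graph obtained from $k$ copies of $K_n$ by identifying one vertex $v$ of each copy into a single common vertex, so that any two copies are edge-disjoint and share only $v$. For a graph $G$ of order $p$, $D(u,v)$ is the length of a longest $u$–$v$ path; a hamiltonian coloring is a map $c:V(G)\to\{0,1,2,\dots\}$ with $D(u,v)+|c(u)-c(v)|\ge p-1$ for all distinct $u,v$; $hc(c)=\max_v c(v)$, and $hc(G)$ is the minimum of $hc(c)$ over all hamiltonian colorings $c$ of $G$ (colors start at $0$). -}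

module Defs where

open import Level using (0ℓ)
open import Data.Nat using (ℕ; zero; suc; _+_; _*_; _∸_; _^_; _≤_; ∣_-_∣)
open import Data.Fin using (Fin)
open import Data.Maybe using (Maybe; just; nothing)
open import Data.Product using (Σ; _×_; _,_; ∃)
open import Data.Empty using (⊥)
open import Data.Unit using (⊤)
open import Data.List using (List; []; _∷_)
open import Data.List.Relation.Unary.Unique.Propositional using (Unique)
open import Relation.Binary.PropositionalEquality using (_≡_; _≢_)

record Graph : Set₁ where
  field
    V   : Set
    Adj : V → V → Set
open Graph public

data Walk (G : Graph) : V G → V G → ℕ → Set where
  here : ∀ {u} → Walk G u u 0
  step : ∀ {u w v n} → Adj G u w → Walk G w v n → Walk G u v (suc n)

vertices : ∀ {G u v n} → Walk G u v n → List (V G)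
vertices {u = u} here = u ∷ []
vertices {u = u} (step _ w) = u ∷ vertices w

Path : (G : Graph) → V G → V G → ℕ → Set
Path G u v d = Σ (Walk G u v d) λ w → Unique (vertices w)

IsLongestPathLength : (G : Graph) → V G → V G → ℕ → Set
IsLongestPathLength G u v d = Path G u v d × (∀ e → Path G u v e → e ≤ d)

IsHamiltonianColoring : (G : Graph) (p : ℕ) → (V G → ℕ) → Set
IsHamiltonianColoring G p c =
  ∀ u v → u ≢ v → ∀ d → IsLongestPathLength G u v d → p ∸ 1 ≤ d + ∣ c u - c v ∣

-- hc(G) = h (order p): h is the minimum, over hamiltonian colorings c,
-- of max_v c(v).
HcIs : (G : Graph) (p : ℕ) → ℕ → Set
HcIs G p h =
  (Σ (V G → ℕ) λ c → IsHamiltonianColoring G p c × (∀ v → c v ≤ h) × ∃ λ v → c v ≡ h)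
  × (∀ c → IsHamiltonianColoring G p c → ∃ λ v → h ≤ c v)

-- K_n^k: vertex `nothing` is the common vertex; `just (i , a)` is the a-th
-- non-common vertex of the i-th copy of K_n (each copy has n-1 of them).
KAdj : (n k : ℕ) → Maybe (Fin k × Fin (n ∸ 1)) → Maybe (Fin k × Fin (n ∸ 1)) → Set
KAdj n k nothing nothing = ⊥
KAdj n k nothing (just _) = ⊤
KAdj n k (just _) nothing = ⊤
KAdj n k (just (i , a)) (just (j , b)) = (i ≡ j) × (a ≢ b)

Knk : ℕ → ℕ → Graph
Knk n k = record { V = Maybe (Fin k × Fin (n ∸ 1)) ; Adj = KAdj n k }

orderKnk : ℕ → ℕ → ℕ
orderKnk n k = 1 + k * (n ∸ 1)

-- Write m = n − 1, so that the order is km + 1. A longest u–v path has length 2m when u and v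
-- are non-central vertices of different copies and m otherwise, so a hamiltonian colouring keeps
-- the centre (k − 1)m away from every other vertex and two vertices of one copy (k − 1)m apart,
-- while vertices of different copies need only be g = (k − 2)m apart.
-- For k = 2 the centre and one copy carry m + 1 colours pairwise m apart, so one is at least m².
-- For k ≥ 3 the km non-central colours are pairwise g apart and m + g away from the centre colour
-- c₀. Lifting by m the colours below c₀ merges them with c₀ into km + 1 colours pairwise g apart
-- and all at least m (if c₀ < m, everything already lies above c₀ + m + g), which forces a colour
-- of at least m + kmg = k(k − 2)m² + m. Both bounds are attained by giving vertex a of copy i
-- the colour h + as + ig for suitable h, s and g.
module Submission where

open import Defs
open import Data.Nat using (ℕ; zero; suc; pred; _+_; _*_; _∸_; _^_; _≤_; _<_; z≤n; s≤s; ∣_-_∣; _≤?_)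
open import Data.Nat.Properties
open import Data.Nat.Tactic.RingSolver using (solve-∀)
open import Data.Fin as Fin using (Fin; toℕ; punchIn; remQuot; combine; fromℕ)
import Data.Fin.Properties as Finₚ
open import Data.Maybe as Maybe using (Maybe; just; nothing)
import Data.Maybe.Properties as Maybeₚ
import Data.Product.Properties as Productₚ
open import Data.Product using (Σ; _×_; _,_; ∃; proj₁; proj₂; uncurry)
open import Data.Sum using (_⊎_; inj₁; inj₂)
import Data.Sum
open import Data.Empty using (⊥-elim)
open import Data.Unit using (tt)
open import Data.List using (List; []; _∷_; _++_; map; length; filter; allFin)
open import Data.List.Properties using (length-map; length-++; length-tabulate; filter-notAll; ++-identityʳ)
import Data.List.Relation.Unary.All as All
open import Data.List.Relation.Unary.Any as Any using (here; there)
open import Data.List.Relation.Unary.AllPairs using ([]; _∷_)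
open import Data.List.Relation.Unary.Unique.Propositional using (Unique)
import Data.List.Relation.Unary.Unique.Propositional.Properties as Uniqueₚ
open import Data.List.Relation.Binary.Disjoint.Propositional using (Disjoint)
open import Data.List.Relation.Binary.Subset.Propositional using (_⊆_)
import Data.List.Relation.Binary.Subset.Propositional.Properties as ⊆ₚ
open import Data.List.Membership.Propositional using (_∈_; _∉_)
open import Data.List.Membership.Propositional.Properties using (∈-map⁺; ∈-map⁻; ∈-++⁻; ∈-allFin; ∈-filter⁺; ∈-filter⁻)
open import Function using (_∘_)
open import Relation.Binary.Definitions using (DecidableEquality; tri<; tri≈; tri>)
open import Relation.Binary.PropositionalEquality
open import Relation.Nullary using (¬_; ¬?; yes; no)

module _ {A : Set} (_≟_ : DecidableEquality A) where

  delete : A → List A → List A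
  delete x = filter (λ y → ¬? (x ≟ y))

  Unique-⊆⇒length≤ : ∀ {xs ys : List A} → Unique xs → xs ⊆ ys → length xs ≤ length ys
  Unique-⊆⇒length≤ {[]} _ _ = z≤n
  Unique-⊆⇒length≤ {x ∷ xs} {ys} (x∉xs ∷ xs!) xs⊆ys = begin-strict
    length xs            ≤⟨ Unique-⊆⇒length≤ xs! xs⊆ys-x ⟩
    length (delete x ys) <⟨ filter-notAll _ ys (Any.map (λ x≡y x≢y → x≢y x≡y) (xs⊆ys (here refl))) ⟩
    length ys            ∎
    where
    open ≤-Reasoning
    xs⊆ys-x : xs ⊆ delete x ys
    xs⊆ys-x y∈xs = ∈-filter⁺ _ (xs⊆ys (there y∈xs)) (All.lookup x∉xs y∈xs)

  length-delete : ∀ {x xs} → Unique xs → x ∈ xs → suc (length (delete x xs)) ≡ length xs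
  length-delete {x} {xs} xs! x∈xs = ≤-antisym
    (filter-notAll _ xs (Any.map (λ x≡y x≢y → x≢y x≡y) x∈xs))
    (Unique-⊆⇒length≤ xs! xs⊆x∷xs-x)
    where
    xs⊆x∷xs-x : xs ⊆ x ∷ delete x xs
    xs⊆x∷xs-x {y} y∈xs with x ≟ y
    ... | yes refl = here refl
    ... | no x≢y   = there (∈-filter⁺ _ y∈xs x≢y)

  ∉-delete : ∀ x xs → x ∉ delete x xs
  ∉-delete x xs x∈ = proj₂ (∈-filter⁻ _ {xs = xs} x∈) refl

  Unique-delete : ∀ x {xs} → Unique xs → Unique (delete x xs)
  Unique-delete x = Uniqueₚ.filter⁺ _

  Unique-∷-delete : ∀ x {xs} → Unique xs → Unique (x ∷ delete x xs)
  Unique-∷-delete x {xs} xs! = All.tabulate (λ y∈ → proj₂ (∈-filter⁻ _ {xs = xs} y∈)) ∷ Unique-delete x xs!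

  Unique-∷-delete-∷ : ∀ y {x xs} → Unique (x ∷ xs) → Unique (x ∷ delete y xs)
  Unique-∷-delete-∷ y {xs = xs} (x∉xs ∷ xs!) =
    All.tabulate (λ z∈ → All.lookup x∉xs (proj₁ (∈-filter⁻ _ {xs = xs} z∈))) ∷ Unique-delete y xs!

length-∷ʳ : ∀ {A : Set} (xs : List A) x → length (xs ++ x ∷ []) ≡ suc (length xs)
length-∷ʳ xs x = trans (length-++ xs) (+-comm (length xs) 1)

Unique-∷ʳ : ∀ {A : Set} {xs : List A} {x} → Unique xs → x ∉ xs → Unique (xs ++ x ∷ [])
Unique-∷ʳ xs! x∉xs = Uniqueₚ.++⁺ xs! (All.[] ∷ []) λ { (x∈xs , here refl) → x∉xs x∈xs }

module _ (G : Graph) where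

  Chain : V G → List (V G) → V G → Set
  Chain x []      y = x ≡ y
  Chain x (z ∷ L) y = Adj G x z × Chain z L y

  walk-of-chain : ∀ {x y} L → Chain x L y → Σ (Walk G x y (length L)) λ w → vertices w ≡ x ∷ L
  walk-of-chain []      refl           = here , refl
  walk-of-chain (z ∷ L) (x~z , chain) with walk-of-chain L chain
  ... | w , vertices-w = step x~z w , cong (_ ∷_) vertices-w

  path-of-chain : ∀ {x y} L → Chain x L y → Unique (x ∷ L) → Path G x y (length L)
  path-of-chain L chain x∷L! with walk-of-chain L chain
  ... | w , vertices-w = w , subst Unique (sym vertices-w) x∷L!

  length-vertices : ∀ {u v e} (w : Walk G u v e) → length (vertices w) ≡ suc e
  length-vertices here       = refl
  length-vertices (step _ w) = cong suc (length-vertices w)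

  path-length-bound : DecidableEquality (V G) → ∀ {u v e R} (w : Walk G u v e) →
                      Unique (vertices w) → vertices w ⊆ R → e < length R
  path-length-bound _≟_ w w! w⊆R =
    subst (_≤ _) (length-vertices w) (Unique-⊆⇒length≤ _≟_ w! w⊆R)

  longest-unique : ∀ {u v d d′} → IsLongestPathLength G u v d → IsLongestPathLength G u v d′ → d ≡ d′
  longest-unique (p , longest) (p′ , longest′) = ≤-antisym (longest′ _ p) (longest _ p′)

  separated⇒hamiltonian : ∀ (D : V G → V G → ℕ) → (∀ {u v} → u ≢ v → IsLongestPathLength G u v (D u v)) →
                          ∀ {p c} → (∀ u v → u ≢ v → p ∸ 1 ≤ D u v + ∣ c u - c v ∣) →
                          IsHamiltonianColoring G p c
  separated⇒hamiltonian D longest separated u v u≢v d d-longest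
    rewrite longest-unique d-longest (longest u≢v) = separated u v u≢v

+≤⇒≤∣-∣ : ∀ {a b g} → a + g ≤ b → g ≤ ∣ a - b ∣
+≤⇒≤∣-∣ {a} {b} {g} a+g≤b = begin
  g         ≡⟨ m+n∸m≡n a g ⟨
  a + g ∸ a ≤⟨ ∸-monoˡ-≤ a a+g≤b ⟩
  b ∸ a     ≡⟨ m≤n⇒∣m-n∣≡n∸m (≤-trans (m≤m+n a g) a+g≤b) ⟨
  ∣ a - b ∣ ∎
  where open ≤-Reasoning

+≤⇒≤∣-∣′ : ∀ {a b g} → b + g ≤ a → g ≤ ∣ a - b ∣
+≤⇒≤∣-∣′ {a} {b} b+g≤a = subst (_ ≤_) (∣-∣-comm b a) (+≤⇒≤∣-∣ b+g≤a)

≤∣-∣⇒+≤ : ∀ {a b g} → a ≤ b → g ≤ ∣ a - b ∣ → a + g ≤ b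
≤∣-∣⇒+≤ {a} {b} {g} a≤b g≤∣a-b∣ = begin
  a + g       ≤⟨ +-monoʳ-≤ a (subst (g ≤_) (m≤n⇒∣m-n∣≡n∸m a≤b) g≤∣a-b∣) ⟩
  a + (b ∸ a) ≡⟨ m+[n∸m]≡n a≤b ⟩
  b           ∎
  where open ≤-Reasoning

≤∣-∣⇒+≤⊎+≤ : ∀ {a b g} → g ≤ ∣ a - b ∣ → a + g ≤ b ⊎ b + g ≤ a
≤∣-∣⇒+≤⊎+≤ {a} {b} g≤∣a-b∣ with ≤-total a b
... | inj₁ a≤b = inj₁ (≤∣-∣⇒+≤ a≤b g≤∣a-b∣)
... | inj₂ b≤a = inj₂ (≤∣-∣⇒+≤ b≤a (subst (_ ≤_) (∣-∣-comm a b) g≤∣a-b∣))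

m^2≡m*m : ∀ m → m ^ 2 ≡ m * m
m^2≡m*m m = cong (m *_) (*-identityʳ m)

≢⇒≤∣-∣* : ∀ {a b} g → a ≢ b → g ≤ ∣ a * g - b * g ∣
≢⇒≤∣-∣* {a} {b} g a≢b = begin
  g             ≡⟨ *-identityˡ g ⟨
  1 * g         ≤⟨ *-monoˡ-≤ g (n≢0⇒n>0 (a≢b ∘ ∣m-n∣≡0⇒m≡n)) ⟩
  ∣ a - b ∣ * g ≡⟨ *-distribʳ-∣-∣ g a b ⟩
  ∣ a * g - b * g ∣ ∎
  where open ≤-Reasoning

argmin : ∀ {M} (x : Fin (suc M) → ℕ) → ∃ λ i → ∀ j → x i ≤ x j
argmin {zero}  x = Fin.zero , λ { Fin.zero → ≤-refl }
argmin {suc M} x with argmin (x ∘ Fin.suc)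
... | i , min with ≤-total (x Fin.zero) (x (Fin.suc i))
...   | inj₁ x₀≤xᵢ = Fin.zero , λ { Fin.zero → ≤-refl ; (Fin.suc j) → ≤-trans x₀≤xᵢ (min j) }
...   | inj₂ xᵢ≤x₀ = Fin.suc i , λ { Fin.zero → xᵢ≤x₀ ; (Fin.suc j) → min j }

spread : ∀ M {L g} (x : Fin (suc M) → ℕ) → (∀ i → L ≤ x i) → (∀ i j → i ≢ j → g ≤ ∣ x i - x j ∣) →
         ∃ λ i → L + M * g ≤ x i
spread zero    {L} x L≤x _ = Fin.zero , subst (_≤ x Fin.zero) (sym (+-identityʳ L)) (L≤x Fin.zero)
spread (suc M) {L} {g} x L≤x separated with argmin x
... | i , min with spread M (x ∘ punchIn i) L+g≤x′
                        (λ j j′ j≢j′ → separated _ _ (j≢j′ ∘ Finₚ.punchIn-injective i j j′))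
  where
  L+g≤x′ : ∀ j → L + g ≤ x (punchIn i j)
  L+g≤x′ j = ≤-trans (+-monoˡ-≤ g (L≤x i)) (≤∣-∣⇒+≤ (min _) (separated _ _ (Finₚ.punchInᵢ≢i i j ∘ sym)))
...   | j , reached = punchIn i j , subst (_≤ x (punchIn i j)) (+-assoc L g (M * g)) reached

-- A number at distance at least m + g from c₀ is lifted by m when it lies below c₀:
-- this narrows the gap below c₀ to g and keeps every other gap at least g.
module Lift (m g c₀ : ℕ) where

  Side : ℕ → Set
  Side z = z + (m + g) ≤ c₀ ⊎ c₀ + (m + g) ≤ z

  side : ∀ {z} → m + g ≤ ∣ c₀ - z ∣ → Side z
  side gap = Data.Sum.swap (≤∣-∣⇒+≤⊎+≤ gap)

  lift : ∀ {z} → Side z → ℕ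
  lift {z} (inj₁ _) = m + z
  lift {z} (inj₂ _) = z

  private
    m+z+g≡z+[m+g] : ∀ z → m + z + g ≡ z + (m + g)
    m+z+g≡z+[m+g] z = trans (cong (_+ g) (+-comm m z)) (+-assoc z m g)

    below-above : ∀ {z z′} → z + (m + g) ≤ c₀ → c₀ + (m + g) ≤ z′ → m + z + g ≤ z′
    below-above {z} z+h≤c₀ c₀+h≤z′ = begin
      m + z + g   ≡⟨ m+z+g≡z+[m+g] z ⟩
      z + (m + g) ≤⟨ z+h≤c₀ ⟩
      c₀          ≤⟨ m≤m+n c₀ (m + g) ⟩
      c₀ + (m + g) ≤⟨ c₀+h≤z′ ⟩
      _           ∎
      where open ≤-Reasoning

  lift-≥ : m ≤ c₀ → ∀ {z} (s : Side z) → m ≤ lift s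
  lift-≥ _    {z} (inj₁ _)       = m≤m+n m z
  lift-≥ m≤c₀     (inj₂ c₀+h≤z) = ≤-trans m≤c₀ (≤-trans (m≤m+n c₀ (m + g)) c₀+h≤z)

  lift-centre-gap : ∀ {z} (s : Side z) → g ≤ ∣ c₀ - lift s ∣
  lift-centre-gap {z} (inj₁ z+h≤c₀) = +≤⇒≤∣-∣′ (≤-trans (≤-reflexive (m+z+g≡z+[m+g] z)) z+h≤c₀)
  lift-centre-gap     (inj₂ c₀+h≤z) = +≤⇒≤∣-∣ (≤-trans (+-monoʳ-≤ c₀ (m≤n+m g m)) c₀+h≤z)

  lift-gap : ∀ {z z′} (s : Side z) (s′ : Side z′) → g ≤ ∣ z - z′ ∣ → g ≤ ∣ lift s - lift s′ ∣
  lift-gap {z} {z′} (inj₁ _) (inj₁ _) gap = subst (g ≤_) (sym (∣m+n-m+o∣≡∣n-o∣ m z z′)) gap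
  lift-gap (inj₂ _)       (inj₂ _)       gap = gap
  lift-gap (inj₁ z+h≤c₀) (inj₂ c₀+h≤z′) _   = +≤⇒≤∣-∣ (below-above z+h≤c₀ c₀+h≤z′)
  lift-gap (inj₂ c₀+h≤z) (inj₁ z′+h≤c₀) _   = +≤⇒≤∣-∣′ (below-above z′+h≤c₀ c₀+h≤z)

  lift-attained : ∀ {T z} (s : Side z) → T ≤ lift s → T ≤ c₀ ⊎ T ≤ z
  lift-attained {z = z} (inj₁ z+h≤c₀) T≤m+z = inj₁ (begin
    _           ≤⟨ T≤m+z ⟩
    m + z       ≡⟨ +-comm m z ⟩
    z + m       ≤⟨ +-monoʳ-≤ z (m≤m+n m g) ⟩
    z + (m + g) ≤⟨ z+h≤c₀ ⟩
    c₀          ∎)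
    where open ≤-Reasoning
  lift-attained (inj₂ _) T≤z = inj₂ T≤z

module Around {M m g c₀ : ℕ} (x : Fin (suc M) → ℕ) (separated : ∀ s t → s ≢ t → g ≤ ∣ x s - x t ∣)
              (far : ∀ t → m + g ≤ ∣ c₀ - x t ∣) where
  open Lift m g c₀

  Reached : ℕ → Set
  Reached T = T ≤ c₀ ⊎ ∃ λ t → T ≤ x t

  lifted : Fin (suc (suc M)) → ℕ
  lifted Fin.zero    = c₀
  lifted (Fin.suc t) = lift (side (far t))

  lifted-separated : ∀ s t → s ≢ t → g ≤ ∣ lifted s - lifted t ∣
  lifted-separated Fin.zero    Fin.zero    s≢t = ⊥-elim (s≢t refl)
  lifted-separated Fin.zero    (Fin.suc t) _   = lift-centre-gap (side (far t))
  lifted-separated (Fin.suc s) Fin.zero    _   = subst (g ≤_) (∣-∣-comm c₀ _) (lift-centre-gap (side (far s)))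
  lifted-separated (Fin.suc s) (Fin.suc t) s≢t = lift-gap (side (far s)) (side (far t)) (separated s t (s≢t ∘ cong Fin.suc))

  -- When c₀ ≥ m the lifted family, centre included, is bounded below by m.
  spread-high : m ≤ c₀ → Reached (m + g + M * g)
  spread-high m≤c₀ with spread (suc M) lifted lifted-≥ lifted-separated
    where
    lifted-≥ : ∀ t → m ≤ lifted t
    lifted-≥ Fin.zero    = m≤c₀
    lifted-≥ (Fin.suc t) = lift-≥ m≤c₀ (side (far t))
  ... | Fin.zero    , reached = inj₁ (subst (_≤ c₀) (sym (+-assoc m g (M * g))) reached)
  ... | Fin.suc t   , reached with lift-attained (side (far t)) (subst (_≤ lifted (Fin.suc t)) (sym (+-assoc m g (M * g))) reached)
  ...   | inj₁ T≤c₀ = inj₁ T≤c₀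
  ...   | inj₂ T≤x  = inj₂ (t , T≤x)

  -- When c₀ < m nothing lies below c₀, so the family itself starts at m + g.
  spread-low : c₀ < m → Reached (m + g + M * g)
  spread-low c₀<m = inj₂ (spread M x above separated)
    where
    above : ∀ t → m + g ≤ x t
    above t with side (far t)
    ... | inj₁ xₜ+h≤c₀ = ⊥-elim (<⇒≱ c₀<m (≤-trans (≤-trans (m≤m+n m g) (m≤n+m (m + g) (x t))) xₜ+h≤c₀))
    ... | inj₂ c₀+h≤xₜ = ≤-trans (m≤n+m (m + g) c₀) c₀+h≤xₜ

  spread-around : Reached (m + g + M * g)
  spread-around with m ≤? c₀
  ... | yes m≤c₀ = spread-high m≤c₀
  ... | no  m≰c₀ = spread-low (≰⇒> m≰c₀)

open Around using (spread-around)

leading-digit-gap : ∀ {a b} s t → a ≢ b → s ≤ ∣ a * s + t - (b * s + t) ∣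
leading-digit-gap {a} {b} s t a≢b = subst (s ≤_) ∣as-bs∣≡ (≢⇒≤∣-∣* s a≢b)
  where
  ∣as-bs∣≡ : ∣ a * s - b * s ∣ ≡ ∣ a * s + t - (b * s + t) ∣
  ∣as-bs∣≡ = trans (sym (∣m+n-m+o∣≡∣n-o∣ t (a * s) (b * s))) (cong₂ ∣_-_∣ (+-comm t (a * s)) (+-comm t (b * s)))

carry : ∀ {k s g} → k * g ≤ s → ∀ {a b i} → a < b → i < k → ∀ j → a * s + i * g + g ≤ b * s + j * g
carry {k} {s} {g} kg≤s {a} {b} {i} a<b i<k j = begin
  a * s + i * g + g   ≡⟨ +-assoc (a * s) (i * g) g ⟩
  a * s + (i * g + g) ≡⟨ cong (a * s +_) (+-comm (i * g) g) ⟩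
  a * s + suc i * g   ≤⟨ +-monoʳ-≤ (a * s) (≤-trans (*-monoˡ-≤ g i<k) kg≤s) ⟩
  a * s + s           ≡⟨ +-comm (a * s) s ⟩
  suc a * s           ≤⟨ *-monoˡ-≤ s a<b ⟩
  b * s               ≤⟨ m≤m+n (b * s) (j * g) ⟩
  b * s + j * g       ∎
  where open ≤-Reasoning

trailing-digit-gap : ∀ {k s g} → k * g ≤ s → ∀ a b {i j} → i < k → j < k → i ≢ j →
                     g ≤ ∣ a * s + i * g - (b * s + j * g) ∣
trailing-digit-gap kg≤s a b {i} {j} i<k j<k i≢j with <-cmp a b
... | tri< a<b _ _  = +≤⇒≤∣-∣ (carry kg≤s a<b i<k j)
... | tri> _ _ b<a  = +≤⇒≤∣-∣′ (carry kg≤s b<a j<k i)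
... | tri≈ _ refl _ = subst (_ ≤_) (sym (∣m+n-m+o∣≡∣n-o∣ (a * _) (i * _) (j * _))) (≢⇒≤∣-∣* _ i≢j)

module OnePointUnion (k m : ℕ) where

  G : Graph
  G = Knk (suc m) k

  Vertex : Set
  Vertex = Maybe (Fin k × Fin m)

  _≟ᵛ_ : DecidableEquality Vertex
  _≟ᵛ_ = Maybeₚ.≡-dec (Productₚ.≡-dec Finₚ._≟_ Finₚ._≟_)

  at : Fin k → Fin m → Vertex
  at i a = just (i , a)

  at-injective : ∀ {i j a b} → at i a ≡ at j b → i ≡ j × a ≡ b
  at-injective refl = refl , refl

  copy : Vertex → Maybe (Fin k)
  copy = Maybe.map proj₁

  D : Vertex → Vertex → ℕ
  D nothing        _                = m
  D (just _)       nothing          = m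
  D (just (i , _)) (just (j , _)) with i Finₚ.≟ j
  ... | yes _ = m
  ... | no  _ = m + m

  -- A path that leaves the centre cannot return to it, so it stays within the copies of its ends.

  first-∈ : ∀ {u v e} (w : Walk G u v e) → u ∈ vertices w
  first-∈ here       = here refl
  first-∈ (step _ w) = here refl

  last-∈ : ∀ {u v e} (w : Walk G u v e) → v ∈ vertices w
  last-∈ here       = here refl
  last-∈ (step _ w) = there (last-∈ w)

  copy-constant : ∀ {y v e} (w : Walk G y v e) → nothing ∉ vertices w → All.All (λ z → copy z ≡ copy y) (vertices w)
  copy-constant here                                      _  = refl All.∷ All.[]
  copy-constant {nothing}           (step _ w)              ∉w = ⊥-elim (∉w (here refl))
  copy-constant {just _} (step {w = nothing} _ w)           ∉w = ⊥-elim (∉w (there (first-∈ w)))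
  copy-constant {just _} (step {w = just _} (refl , _) w)   ∉w = refl All.∷ copy-constant w (∉w ∘ there)

  Near : Vertex → Vertex → Vertex → Set
  Near u v z = z ≡ nothing ⊎ copy z ≡ copy u ⊎ copy z ≡ copy v

  path-near : ∀ {u v e} (w : Walk G u v e) → Unique (vertices w) → All.All (Near u v) (vertices w)
  path-near here _ = inj₂ (inj₁ refl) All.∷ All.[]
  path-near {nothing} (step {w = y} _ w) (nothing∉w ∷ _) =
    inj₁ refl All.∷ All.map (λ copy≡ → inj₂ (inj₂ (trans copy≡ (sym (All.lookup same (last-∈ w)))))) same
    where
    same : All.All (λ z → copy z ≡ copy y) (vertices w)
    same = copy-constant w (λ nothing∈w → All.lookup nothing∉w nothing∈w refl)
  path-near {just x} {v} (step {w = nothing} _ w) (_ ∷ w!) = inj₂ (inj₁ refl) All.∷ All.map widen (path-near w w!)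
    where
    widen : ∀ {z} → Near nothing v z → Near (just x) v z
    widen (inj₁ z≡nothing)           = inj₁ z≡nothing
    widen {nothing} (inj₂ _)         = inj₁ refl
    widen {just _} (inj₂ (inj₁ ()))
    widen {just _} (inj₂ (inj₂ eq))  = inj₂ (inj₂ eq)
  path-near {just _} (step {w = just _} (refl , _) w) (_ ∷ w!) = inj₂ (inj₁ refl) All.∷ path-near w w!

  copyVertices : Maybe (Fin k) → List Vertex
  copyVertices nothing  = []
  copyVertices (just i) = map (at i) (allFin m)

  length-copyVertices : ∀ i → length (copyVertices (just i)) ≡ m
  length-copyVertices i = trans (length-map (at i) (allFin m)) (length-tabulate _)

  ∈-centre∷copy : ∀ z → z ∈ nothing ∷ copyVertices (copy z)
  ∈-centre∷copy nothing        = here refl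
  ∈-centre∷copy (just (i , a)) = there (∈-map⁺ (at i) (∈-allFin a))

  region : Vertex → Vertex → List Vertex
  region u v = nothing ∷ copyVertices (copy u) ++ copyVertices (copy v)

  near-∈-region : ∀ {u v z} → Near u v z → z ∈ region u v
  near-∈-region (inj₁ refl) = here refl
  near-∈-region {u} {v} {z} (inj₂ (inj₁ eq)) =
    ⊆ₚ.∷⁺ʳ nothing (⊆ₚ.xs⊆xs++ys _ _) (subst (λ c → z ∈ nothing ∷ copyVertices c) eq (∈-centre∷copy z))
  near-∈-region {u} {v} {z} (inj₂ (inj₂ eq)) =
    ⊆ₚ.∷⁺ʳ nothing (⊆ₚ.xs⊆ys++xs _ _) (subst (λ c → z ∈ nothing ∷ copyVertices c) eq (∈-centre∷copy z))

  path-⊆-region : ∀ {u v e} (w : Walk G u v e) → Unique (vertices w) → vertices w ⊆ region u v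
  path-⊆-region {u} {v} w w! = near-∈-region {u} {v} ∘ All.lookup (path-near w w!)

  bounded-by : ∀ {u v e d} (w : Walk G u v e) → Unique (vertices w) → ∀ {R} →
               vertices w ⊆ R → length R ≡ suc d → e ≤ d
  bounded-by w w! w⊆R |R|≡ = ≤-pred (subst (_ <_) |R|≡ (path-length-bound G _≟ᵛ_ w w! w⊆R))

  path-bound : ∀ {u v e} → u ≢ v → (w : Walk G u v e) → Unique (vertices w) → e ≤ D u v
  path-bound {nothing} {nothing} u≢v _ _ = ⊥-elim (u≢v refl)
  path-bound {nothing} {just (j , _)} _ w w! = bounded-by w w! (path-⊆-region w w!) (cong suc (length-copyVertices j))
  path-bound {just (i , _)} {nothing} _ w w! = bounded-by w w! (path-⊆-region w w!)
    (cong suc (trans (cong length (++-identityʳ (copyVertices (just i)))) (length-copyVertices i)))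
  path-bound {just (i , _)} {just (j , _)} _ w w! with i Finₚ.≟ j
  ... | yes refl = bounded-by w w!
                     (⊆ₚ.∷⁺ʳ nothing (Data.Sum.reduce ∘ ∈-++⁻ (copyVertices (just i))) ∘ path-⊆-region w w!)
                     (cong suc (length-copyVertices i))
  ... | no  _    = bounded-by w w! (path-⊆-region w w!)
    (cong suc (trans (length-++ (copyVertices (just i))) (cong₂ _+_ (length-copyVertices i) (length-copyVertices j))))

  -- Longest paths sweep the rest of one copy, pass through the centre and sweep the other copy.

  others : Fin m → List (Fin m)
  others a = delete Finₚ._≟_ a (allFin m)

  length-others : ∀ a → suc (length (others a)) ≡ m
  length-others a = trans (length-delete Finₚ._≟_ (Uniqueₚ.allFin⁺ m) (∈-allFin a)) (length-tabulate _)

  others! : ∀ a → Unique (others a)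
  others! a = Unique-delete Finₚ._≟_ a (Uniqueₚ.allFin⁺ m)

  others-∷ʳ! : ∀ b → Unique (others b ++ b ∷ [])
  others-∷ʳ! b = Unique-∷ʳ (others! b) (∉-delete Finₚ._≟_ b (allFin m))

  ∷-others! : ∀ a → Unique (a ∷ others a)
  ∷-others! a = Unique-∷-delete Finₚ._≟_ a (Uniqueₚ.allFin⁺ m)

  length-sweep : ∀ j b → length (map (at j) (others b ++ b ∷ [])) ≡ m
  length-sweep j b = trans (length-map (at j) (others b ++ b ∷ [])) (trans (length-∷ʳ (others b) b) (length-others b))

  sweep : ∀ i a xs b → Unique (a ∷ xs ++ b ∷ []) → Chain G (at i a) (map (at i) (xs ++ b ∷ [])) (at i b)
  sweep i a []       b ((a≢b All.∷ All.[]) ∷ _) = (refl , a≢b) , refl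
  sweep i a (x ∷ xs) b ((a≢x All.∷ _) ∷ x∷xs!) = (refl , a≢x) , sweep i x xs b x∷xs!

  sweep-from-centre : ∀ i xs b → Unique (xs ++ b ∷ []) → Chain G nothing (map (at i) (xs ++ b ∷ [])) (at i b)
  sweep-from-centre i []       b _     = tt , refl
  sweep-from-centre i (x ∷ xs) b x∷xs! = tt , sweep i x xs b x∷xs!

  sweep-to-centre : ∀ i a xs {R y} → Unique (a ∷ xs) → Chain G nothing R y →
                    Chain G (at i a) (map (at i) xs ++ nothing ∷ R) y
  sweep-to-centre i a []       _                     chain = tt , chain
  sweep-to-centre i a (x ∷ xs) ((a≢x All.∷ _) ∷ x∷xs!) chain = (refl , a≢x) , sweep-to-centre i x xs x∷xs! chain

  centre-∉ : ∀ i xs → nothing ∉ map (at i) xs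
  centre-∉ i xs nothing∈ with ∈-map⁻ (at i) nothing∈
  ... | _ , _ , ()

  Unique-through-centre : ∀ i j {P Q} → Unique P → Unique Q → (i ≡ j → Disjoint P Q) →
                          Unique (map (at i) P ++ nothing ∷ map (at j) Q)
  Unique-through-centre i j {P} {Q} P! Q! disjoint =
    Uniqueₚ.++⁺ (Uniqueₚ.map⁺ (proj₂ ∘ at-injective) P!)
                (All.tabulate (λ z∈ nothing≡z → centre-∉ j Q (subst (_∈ _) (sym nothing≡z) z∈))
                  ∷ Uniqueₚ.map⁺ (proj₂ ∘ at-injective) Q!)
                apart
    where
    apart : Disjoint (map (at i) P) (nothing ∷ map (at j) Q)
    apart (nothing∈ , here refl) = centre-∉ i P nothing∈
    apart (z∈P , there z∈Q) with ∈-map⁻ (at i) z∈P | ∈-map⁻ (at j) z∈Q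
    ... | x , x∈P , refl | y , y∈Q , eq with at-injective eq
    ...   | i≡j , refl = disjoint i≡j (x∈P , y∈Q)

  length-through-centre : ∀ i xs R → length (map (at i) xs ++ nothing ∷ R) ≡ suc (length xs) + length R
  length-through-centre i xs R = begin
    length (map (at i) xs ++ nothing ∷ R)   ≡⟨ length-++ (map (at i) xs) ⟩
    length (map (at i) xs) + suc (length R) ≡⟨ +-suc (length (map (at i) xs)) (length R) ⟩
    suc (length (map (at i) xs) + length R) ≡⟨ cong (λ l → suc (l + length R)) (length-map (at i) xs) ⟩
    suc (length xs) + length R              ∎
    where open ≡-Reasoning

  path-from-centre : ∀ j b → Path G nothing (at j b) m
  path-from-centre j b = subst (Path G nothing (at j b)) (length-sweep j b)
    (path-of-chain G _ (sweep-from-centre j (others b) b (others-∷ʳ! b))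
                       (Unique-through-centre j j [] (others-∷ʳ! b) λ _ → λ ()))

  path-to-centre : ∀ i a → Path G (at i a) nothing m
  path-to-centre i a = subst (Path G (at i a) nothing) |L|≡m
    (path-of-chain G _ (sweep-to-centre i a (others a) (∷-others! a) refl)
                       (Unique-through-centre i i (∷-others! a) [] λ _ → λ ()))
    where
    |L|≡m : length (map (at i) (others a) ++ nothing ∷ []) ≡ m
    |L|≡m = trans (length-through-centre i (others a) []) (trans (+-identityʳ _) (length-others a))

  path-within-copy : ∀ i a b → a ≢ b → Path G (at i a) (at i b) m
  path-within-copy i a b a≢b = subst (Path G (at i a) (at i b)) |L|≡m
    (path-of-chain G _ (sweep-to-centre i a middle a∷middle! (sweep-from-centre i [] b (All.[] ∷ [])))
                       (Unique-through-centre i i a∷middle! (All.[] ∷ []) λ _ → b∉a∷middle))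
    where
    middle = delete Finₚ._≟_ b (others a)
    a∷middle! : Unique (a ∷ middle)
    a∷middle! = Unique-∷-delete-∷ Finₚ._≟_ b (∷-others! a)
    b∈others : b ∈ others a
    b∈others = ∈-filter⁺ _ (∈-allFin b) a≢b
    b∉a∷middle : ∀ {z} → ¬ (z ∈ a ∷ middle × z ∈ b ∷ [])
    b∉a∷middle (here refl , here refl) = a≢b refl
    b∉a∷middle (there b∈ , here refl)  = ∉-delete Finₚ._≟_ b (others a) b∈
    |L|≡m : length (map (at i) middle ++ nothing ∷ map (at i) (b ∷ [])) ≡ m
    |L|≡m = begin
      length (map (at i) middle ++ nothing ∷ map (at i) (b ∷ [])) ≡⟨ length-through-centre i middle _ ⟩
      suc (length middle) + 1                                      ≡⟨ +-comm (suc (length middle)) 1 ⟩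
      suc (suc (length middle))                                    ≡⟨ cong suc (length-delete Finₚ._≟_ (others! a) b∈others) ⟩
      suc (length (others a))                                      ≡⟨ length-others a ⟩
      m                                                            ∎
      where open ≡-Reasoning

  path-across : ∀ i a j b → i ≢ j → Path G (at i a) (at j b) (m + m)
  path-across i a j b i≢j = subst (Path G (at i a) (at j b)) |L|≡m+m
    (path-of-chain G _ (sweep-to-centre i a (others a) (∷-others! a) (sweep-from-centre j (others b) b (others-∷ʳ! b)))
                       (Unique-through-centre i j (∷-others! a) (others-∷ʳ! b) (⊥-elim ∘ i≢j)))
    where
    |L|≡m+m : length (map (at i) (others a) ++ nothing ∷ map (at j) (others b ++ b ∷ [])) ≡ m + m
    |L|≡m+m = trans (length-through-centre i (others a) _) (cong₂ _+_ (length-others a) (length-sweep j b))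

  longest-path : ∀ {u v} → u ≢ v → Path G u v (D u v)
  longest-path {nothing}      {nothing}      u≢v = ⊥-elim (u≢v refl)
  longest-path {nothing}      {just (j , b)} _   = path-from-centre j b
  longest-path {just (i , a)} {nothing}      _   = path-to-centre i a
  longest-path {just (i , a)} {just (j , b)} u≢v with i Finₚ.≟ j
  ... | yes refl = path-within-copy i a b (u≢v ∘ cong (at i))
  ... | no  i≢j  = path-across i a j b i≢j

  D-longest : ∀ {u v} → u ≢ v → IsLongestPathLength G u v (D u v)
  D-longest u≢v = longest-path u≢v , λ _ (w , w!) → path-bound u≢v w w!

  D-same-copy : ∀ i a b → D (at i a) (at i b) ≡ m
  D-same-copy i a b with i Finₚ.≟ i
  ... | yes _  = refl
  ... | no i≢i = ⊥-elim (i≢i refl)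

  D-≤ : ∀ u v → D u v ≤ m + m
  D-≤ nothing        _              = m≤m+n m m
  D-≤ (just _)       nothing        = m≤m+n m m
  D-≤ (just (i , _)) (just (j , _)) with i Finₚ.≟ j
  ... | yes _ = m≤m+n m m
  ... | no  _ = ≤-refl

  p : ℕ
  p = orderKnk (suc m) k

  separation : ∀ c → IsHamiltonianColoring G p c → ∀ {u v} → u ≢ v → k * m ≤ D u v + ∣ c u - c v ∣
  separation _ hc u≢v = hc _ _ u≢v _ (D-longest u≢v)

  -- In h + a s + i g the vertex a is the leading and the copy i the trailing digit: vertices of
  -- one copy get colours s apart, those of different copies colours g apart.
  module Colouring (h s g : ℕ) (centre : k * m ≤ m + h) (same : k * m ≤ m + s)
                   (across : k * m ≤ m + m + g) (kg≤s : k * g ≤ s) where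

    colour : Vertex → ℕ
    colour nothing        = 0
    colour (just (i , a)) = h + (toℕ a * s + toℕ i * g)

    colour-separated : ∀ u v → u ≢ v → k * m ≤ D u v + ∣ colour u - colour v ∣
    colour-separated nothing        nothing        u≢v = ⊥-elim (u≢v refl)
    colour-separated nothing        (just _)       _   = ≤-trans centre (+-monoʳ-≤ m (m≤m+n h _))
    colour-separated (just _)       nothing        _   =
      ≤-trans centre (+-monoʳ-≤ m (subst (h ≤_) (sym (∣-∣-identityʳ _)) (m≤m+n h _)))
    colour-separated (just (i , a)) (just (j , b)) u≢v with i Finₚ.≟ j
    ... | yes refl = ≤-trans same (+-monoʳ-≤ m (subst (s ≤_) (sym (∣m+n-m+o∣≡∣n-o∣ h _ _))
                       (leading-digit-gap s (toℕ i * g) (u≢v ∘ cong (at i) ∘ Finₚ.toℕ-injective))))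
    ... | no  i≢j  = ≤-trans across (+-monoʳ-≤ (m + m) (subst (g ≤_) (sym (∣m+n-m+o∣≡∣n-o∣ h _ _))
                       (trailing-digit-gap kg≤s (toℕ a) (toℕ b) (Finₚ.toℕ<n i) (Finₚ.toℕ<n j)
                                           (i≢j ∘ Finₚ.toℕ-injective))))

    colour-hamiltonian : IsHamiltonianColoring G p colour
    colour-hamiltonian = separated⇒hamiltonian G D D-longest {p} {colour} colour-separated

    colour-≤ : ∀ v → colour v ≤ h + (pred m * s + pred k * g)
    colour-≤ nothing        = z≤n
    colour-≤ (just (i , a)) =
      +-monoʳ-≤ h (+-mono-≤ (*-monoˡ-≤ s (<⇒≤pred (Finₚ.toℕ<n a))) (*-monoˡ-≤ g (<⇒≤pred (Finₚ.toℕ<n i))))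

  noncentral : Fin (k * m) → Vertex
  noncentral t = just (remQuot {k} m t)

  noncentral-injective : ∀ {s t} → s ≢ t → noncentral s ≢ noncentral t
  noncentral-injective {s} {t} s≢t eq = s≢t (begin
    s                                 ≡⟨ Finₚ.combine-remQuot {k} m s ⟨
    uncurry combine (remQuot {k} m s) ≡⟨ cong (uncurry combine) (Maybeₚ.just-injective eq) ⟩
    uncurry combine (remQuot {k} m t) ≡⟨ Finₚ.combine-remQuot {k} m t ⟩
    t                                 ∎)
    where open ≡-Reasoning

hc-two-copies : ∀ m′ → HcIs (Knk (2 + m′) 2) (orderKnk (2 + m′) 2) (suc m′ ^ 2)
hc-two-copies m′ = (colour , colour-hamiltonian , colour-≤m² , (at Fin.zero (fromℕ m′) , top-colour)) , lower
  where
  m = suc m′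
  open OnePointUnion 2 m
  2m≡m+m : 2 * m ≡ m + m
  2m≡m+m = cong (m +_) (+-identityʳ m)
  open Colouring m m 0 (≤-reflexive 2m≡m+m) (≤-reflexive 2m≡m+m)
                       (≤-reflexive (trans 2m≡m+m (sym (+-identityʳ (m + m))))) z≤n

  max-colour : m + (m′ * m + 0) ≡ m ^ 2
  max-colour = trans (cong (m +_) (+-identityʳ (m′ * m))) (sym (m^2≡m*m m))

  colour-≤m² : ∀ v → colour v ≤ m ^ 2
  colour-≤m² v = ≤-trans (colour-≤ v) (≤-reflexive max-colour)

  top-colour : colour (at Fin.zero (fromℕ m′)) ≡ m ^ 2
  top-colour = trans (cong (λ a → m + (a * m + 0)) (Finₚ.toℕ-fromℕ m′)) max-colour

  centre∷copy₀ : Fin (suc m) → Vertex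
  centre∷copy₀ Fin.zero    = nothing
  centre∷copy₀ (Fin.suc a) = at Fin.zero a

  centre∷copy₀-injective : ∀ {s t} → s ≢ t → centre∷copy₀ s ≢ centre∷copy₀ t
  centre∷copy₀-injective {Fin.zero}  {Fin.zero}  s≢t _    = s≢t refl
  centre∷copy₀-injective {Fin.suc a} {Fin.suc b} s≢t refl = s≢t refl

  D-centre∷copy₀ : ∀ s t → D (centre∷copy₀ s) (centre∷copy₀ t) ≡ m
  D-centre∷copy₀ Fin.zero    _           = refl
  D-centre∷copy₀ (Fin.suc a) Fin.zero    = refl
  D-centre∷copy₀ (Fin.suc a) (Fin.suc b) = D-same-copy Fin.zero a b

  apart : ∀ c → IsHamiltonianColoring G p c → ∀ s t → s ≢ t →
          m ≤ ∣ c (centre∷copy₀ s) - c (centre∷copy₀ t) ∣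
  apart c hc s t s≢t = +-cancelˡ-≤ m m Δ (begin
    m + m                                   ≡⟨ 2m≡m+m ⟨
    2 * m                                   ≤⟨ separation c hc (centre∷copy₀-injective s≢t) ⟩
    D (centre∷copy₀ s) (centre∷copy₀ t) + Δ ≡⟨ cong (_+ Δ) (D-centre∷copy₀ s t) ⟩
    m + Δ                                   ∎)
    where
    Δ = ∣ c (centre∷copy₀ s) - c (centre∷copy₀ t) ∣
    open ≤-Reasoning

  lower : ∀ c → IsHamiltonianColoring G p c → ∃ λ v → m ^ 2 ≤ c v
  lower c hc with spread m (c ∘ centre∷copy₀) (λ _ → z≤n) (apart c hc)
  ... | t , reached = centre∷copy₀ t , subst (_≤ c (centre∷copy₀ t)) (sym (m^2≡m*m m)) reached

hc-many-copies : ∀ k′ m′ → HcIs (Knk (2 + m′) (3 + k′)) (orderKnk (2 + m′) (3 + k′))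
                                ((3 + k′) * (1 + k′) * suc m′ ^ 2 + suc m′)
hc-many-copies k′ m′ =
  (colour , colour-hamiltonian , colour-≤target , (at (fromℕ (2 + k′)) (fromℕ m′) , top-colour)) , lower
  where
  k = 3 + k′
  m = suc m′
  g = (1 + k′) * m
  open OnePointUnion k m

  m+g≤kg : m + g ≤ k * g
  m+g≤kg = ≤-trans (+-monoˡ-≤ g (m≤m+n m (k′ * m))) (+-monoʳ-≤ g (m≤m+n g _))

  open Colouring (m + g) (k * g) g ≤-refl (+-monoʳ-≤ m m+g≤kg) (≤-reflexive (sym (+-assoc m m g))) ≤-refl

  max-colour-identity : ∀ k′ m′ →
    (1 + m′) + (1 + k′) * (1 + m′) + (m′ * ((3 + k′) * ((1 + k′) * (1 + m′))) + (2 + k′) * ((1 + k′) * (1 + m′)))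
      ≡ (3 + k′) * (1 + k′) * ((1 + m′) * (1 + m′)) + (1 + m′)
  max-colour-identity = solve-∀

  spread-identity : ∀ k′ m′ →
    (1 + m′) + (1 + k′) * (1 + m′) + (m′ + (2 + k′) * (1 + m′)) * ((1 + k′) * (1 + m′))
      ≡ (3 + k′) * (1 + k′) * ((1 + m′) * (1 + m′)) + (1 + m′)
  spread-identity = solve-∀

  target = k * (1 + k′) * m ^ 2 + m

  in-target : ∀ {x} → x ≡ k * (1 + k′) * (m * m) + m → x ≡ target
  in-target x≡ = trans x≡ (cong (λ y → k * (1 + k′) * y + m) (sym (m^2≡m*m m)))

  max-colour : m + g + (m′ * (k * g) + (2 + k′) * g) ≡ target
  max-colour = in-target (max-colour-identity k′ m′)

  spread-value : m + g + (m′ + (2 + k′) * m) * g ≡ target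
  spread-value = in-target (spread-identity k′ m′)

  colour-≤target : ∀ v → colour v ≤ target
  colour-≤target v = ≤-trans (colour-≤ v) (≤-reflexive max-colour)

  top-colour : colour (at (fromℕ (2 + k′)) (fromℕ m′)) ≡ target
  top-colour = trans (cong₂ (λ a i → m + g + (a * (k * g) + i * g)) (Finₚ.toℕ-fromℕ m′) (Finₚ.toℕ-fromℕ (2 + k′)))
                     max-colour

  noncentral-apart : ∀ c → IsHamiltonianColoring G p c → ∀ s t → s ≢ t →
                     g ≤ ∣ c (noncentral s) - c (noncentral t) ∣
  noncentral-apart c hc s t s≢t = +-cancelˡ-≤ (m + m) g Δ (begin
    m + m + g                           ≡⟨ +-assoc m m g ⟩
    k * m                               ≤⟨ separation c hc (noncentral-injective s≢t) ⟩
    D (noncentral s) (noncentral t) + Δ ≤⟨ +-monoˡ-≤ Δ (D-≤ (noncentral s) (noncentral t)) ⟩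
    m + m + Δ                           ∎)
    where
    Δ = ∣ c (noncentral s) - c (noncentral t) ∣
    open ≤-Reasoning

  noncentral-far : ∀ c → IsHamiltonianColoring G p c → ∀ t → m + g ≤ ∣ c nothing - c (noncentral t) ∣
  noncentral-far c hc t = +-cancelˡ-≤ m (m + g) _ (separation c hc {nothing} {noncentral t} (λ ()))

  lower : ∀ c → IsHamiltonianColoring G p c → ∃ λ v → target ≤ c v
  lower c hc with spread-around {M = m′ + (2 + k′) * m} {m} {g} (c ∘ noncentral) (noncentral-apart c hc) (noncentral-far c hc)
  ... | inj₁ reached       = nothing , subst (_≤ c nothing) spread-value reached
  ... | inj₂ (t , reached) = noncentral t , subst (_≤ c (noncentral t)) spread-value reached

theorem6 : (n k : ℕ) → 2 ≤ n → 2 ≤ k →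
    (k ≡ 2 → HcIs (Knk n k) (orderKnk n k) ((n ∸ 1) ^ 2))
    × (3 ≤ k → HcIs (Knk n k) (orderKnk n k) (k * (k ∸ 2) * (n ∸ 1) ^ 2 + (n ∸ 1)))
theorem6 (suc zero) _ (s≤s ()) _
theorem6 (suc (suc m′)) k _ _ = two-copies , many-copies
  where
  two-copies : k ≡ 2 → HcIs (Knk (2 + m′) k) (orderKnk (2 + m′) k) (suc m′ ^ 2)
  two-copies refl = hc-two-copies m′
  many-copies : 3 ≤ k → HcIs (Knk (2 + m′) k) (orderKnk (2 + m′) k) (k * (k ∸ 2) * suc m′ ^ 2 + suc m′)
  many-copies (s≤s (s≤s (s≤s {n = k′} _))) = hc-many-copies k′ m′
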